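{- Let $G$ be a graph and $c$ a positive integer. If $G$ has no two adjacent vertices both of degree at least $c+1$, then $\overrightarrow{\chi}(G)\leq c$.
   Context: An orientation $D$ of a graph $G$ replaces each edge by exactly one of its two possible arcs; $d^-_D(v)$ is the indegree of $v$. $D$ is proper if adjacent vertices have distinct indegrees; a $k$-orientation has maximum indegree at most $k$. $\overrightarrow{\chi}(G)$ is the minimum $k$ such that $G$ admits a proper $k$-orientation. -}

module Defs where

open import Data.Nat using (ℕ; zero; suc; _+_; _≤_)
open import Data.Fin using (Fin) renaming (zero to fzero; suc to fsuc)
open import Data.Bool using (Bool; true; false; if_then_else_)
open import Relation.Binary.PropositionalEquality using (_≡_; _≢_)
open import Data.Product using (Σ; _×_)
open import Data.Empty using (⊥)

count : {n : ℕ} → (Fin n → Bool) → ℕ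
count {zero}  p = 0
count {suc n} p = (if p fzero then 1 else 0) + count (λ i → p (fsuc i))

record Graph : Set where
  field
    n     : ℕ
    adj   : Fin n → Fin n → Bool
    sym   : ∀ u v → adj u v ≡ adj v u
    irrefl : ∀ v → adj v v ≡ false

open Graph public

Adjacent : (G : Graph) → Fin (n G) → Fin (n G) → Set
Adjacent G u v = adj G u v ≡ true

degree : (G : Graph) → Fin (n G) → ℕ
degree G v = count (λ u → adj G u v)

-- An orientation of G: arc u v ≡ true means the edge uv is oriented u → v.
-- Each edge is replaced by exactly one of its two arcs; no arcs between non-adjacent vertices.
record Orientation (G : Graph) : Set where
  field
    arc      : Fin (n G) → Fin (n G) → Bool
    arc-edge : ∀ u v → arc u v ≡ true → Adjacent G u v
    one-way  : ∀ u v → arc u v ≡ true → arc v u ≡ false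
    some-way : ∀ u v → Adjacent G u v → arc u v ≡ false → arc v u ≡ true

open Orientation public

indegree : {G : Graph} → Orientation G → Fin (n G) → ℕ
indegree D v = count (λ u → arc D u v)

Proper : {G : Graph} → Orientation G → Set
Proper {G} D = ∀ u v → Adjacent G u v → indegree D u ≢ indegree D v

IsKOrientation : {G : Graph} → ℕ → Orientation G → Set
IsKOrientation {G} k D = ∀ v → indegree D v ≤ k

-- proper orientation number is at most k  ⟺  G admits a proper k-orientation
-- (χ⃗(G) is the minimum such k, so χ⃗(G) ≤ k iff a proper k-orientation exists,
--  a proper k'-orientation with k' ≤ k being also a proper k-orientation)
ProperOrientationNumber≤ : Graph → ℕ → Set
ProperOrientationNumber≤ G k = Σ (Orientation G) λ D → Proper D × IsKOrientation k D

-- Start from an orientation in which every vertex of degree > c is a source; this is possible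
-- because such vertices are pairwise non-adjacent. While some arc u → v joins vertices of equal
-- indegree d, reverse it: u goes to d + 1 and v to d - 1, so the sum of squared indegrees grows
-- by exactly 2, and being bounded this can only happen finitely often. Both ends of a reversed
-- arc have positive indegree, so sources stay sources. The final orientation is proper, big
-- vertices have indegree 0, and any other vertex has indegree at most its degree, hence at most c.
module Submission where

open import Defs hiding (sym)
open import Data.Nat.Properties
open import Algebra.Properties.CommutativeSemigroup +-commutativeSemigroup using (x∙yz≈y∙xz)
open import Algebra.Properties.CommutativeMonoid.Sum +-0-commutativeMonoid using (sum; sum-cong-≗; sum-remove)
open import Data.Bool using (Bool; true; false; if_then_else_; _∧_)
open import Data.Bool.Properties using (∧-zeroʳ; ∧-conicalʳ; T-≡) renaming (_≟_ to _≟ᵇ_)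
open import Data.Empty using (⊥-elim)
open import Data.Fin using (Fin; toℕ; punchIn) renaming (zero to fzero; suc to fsuc; _≟_ to _≟ᶠ_)
open import Data.Fin.Properties using (any?; toℕ-injective; punchInᵢ≢i) renaming (suc-injective to fsuc-injective)
open import Data.Nat using (ℕ; zero; suc; _+_; _*_; _≤_; _<_; z≤n; s≤s; z<s; _<?_)
open import Data.Nat.Tactic.RingSolver using (solve-∀)
open import Data.Product using (Σ; ∃; ∃₂; _×_; _,_; proj₁; proj₂)
import Data.Product as Product
open import Data.Sum using (_⊎_; inj₁; inj₂; [_,_])
import Data.Sum as Sum
open import Data.Vec.Functional using (updateAt)
open import Data.Vec.Functional.Properties using (updateAt-updates; updateAt-minimal)
open import Level using (Level; 0ℓ)
open import Function using (_∘_; const; Equivalence)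
open import Relation.Binary using (Rel; Decidable; Symmetric)
open import Relation.Nullary using (¬_; Dec; yes; no; does)
open import Relation.Nullary.Decidable using (dec-true; dec-false; _×-dec_; _⊎-dec_)
open import Relation.Binary.PropositionalEquality using (_≡_; _≢_; refl; sym; trans; cong; cong₂; subst; module ≡-Reasoning)

count-cong : ∀ {m} {p q : Fin m → Bool} → (∀ i → p i ≡ q i) → count p ≡ count q
count-cong {zero}  eq = refl
count-cong {suc m} eq = cong₂ _+_ (cong (λ b → if b then 1 else 0) (eq fzero)) (count-cong (eq ∘ fsuc))

count-≤ : ∀ {m} (p : Fin m → Bool) → count p ≤ m
count-≤ {zero}  p = z≤n
count-≤ {suc m} p with p fzero
... | true  = s≤s (count-≤ (p ∘ fsuc))
... | false = m≤n⇒m≤1+n (count-≤ (p ∘ fsuc))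

count-mono : ∀ {m} {p q : Fin m → Bool} → (∀ i → p i ≡ true → q i ≡ true) → count p ≤ count q
count-mono {zero}          p⇒q = z≤n
count-mono {suc m} {p} {q} p⇒q with p fzero in p₀ | q fzero in q₀
... | true  | true  = s≤s (count-mono (p⇒q ∘ fsuc))
... | true  | false with () ← trans (sym q₀) (p⇒q fzero p₀)
... | false | true  = m≤n⇒m≤1+n (count-mono (p⇒q ∘ fsuc))
... | false | false = count-mono (p⇒q ∘ fsuc)

count-none : ∀ {m} {p : Fin m → Bool} → (∀ i → p i ≡ false) → count p ≡ 0
count-none {zero}  none = refl
count-none {suc m} none rewrite none fzero = count-none (none ∘ fsuc)

count-update : ∀ {m} {p q : Fin m → Bool} (i : Fin m) → p i ≡ true → q i ≡ false →
               (∀ j → j ≢ i → p j ≡ q j) → count p ≡ suc (count q)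
count-update fzero p₀ q₀ eq rewrite p₀ | q₀ = cong suc (count-cong (λ j → eq (fsuc j) λ ()))
count-update {suc m} {p} {q} (fsuc i) pᵢ qᵢ eq = begin
  (if p fzero then 1 else 0) + count (p ∘ fsuc)       ≡⟨ cong₂ _+_ (cong (λ b → if b then 1 else 0) (eq fzero λ ()))
                                                              (count-update i pᵢ qᵢ (λ j j≢i → eq (fsuc j) (j≢i ∘ fsuc-injective))) ⟩
  (if q fzero then 1 else 0) + suc (count (q ∘ fsuc)) ≡⟨ +-suc _ _ ⟩
  suc (count q)                                       ∎
  where open ≡-Reasoning

sum-agree-off : ∀ {m} {f g : Fin m → ℕ} (i : Fin m) → (∀ j → j ≢ i → f j ≡ g j) →
                f i + sum g ≡ g i + sum f
sum-agree-off {suc m} {f} {g} i eq = begin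
  f i + sum g                      ≡⟨ cong (f i +_) (sum-remove {i = i} g) ⟩
  f i + (g i + sum (g ∘ punchIn i)) ≡⟨ cong (λ s → f i + (g i + s)) (sum-cong-≗ λ j → sym (eq _ (punchInᵢ≢i i j))) ⟩
  f i + (g i + sum (f ∘ punchIn i)) ≡⟨ x∙yz≈y∙xz (f i) (g i) _ ⟩
  g i + (f i + sum (f ∘ punchIn i)) ≡⟨ cong (g i +_) (sum-remove {i = i} f) ⟨
  g i + sum f                      ∎
  where open ≡-Reasoning

sum-agree-off₂ : ∀ {m} {f g : Fin m → ℕ} (u v : Fin m) → u ≢ v → (∀ j → j ≢ u → j ≢ v → f j ≡ g j) →
                 f u + f v + sum g ≡ g u + g v + sum f
sum-agree-off₂ {f = f} {g} u v u≢v eq = begin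
  f u + f v + sum g   ≡⟨ +-assoc (f u) _ _ ⟩
  f u + (f v + sum g) ≡⟨ cong (λ x → f u + (x + sum g)) (hᵥ≡fᵥ) ⟨
  f u + (h v + sum g) ≡⟨ cong (f u +_) (sum-agree-off v h≡g) ⟩
  f u + (g v + sum h) ≡⟨ x∙yz≈y∙xz (f u) (g v) _ ⟩
  g v + (f u + sum h) ≡⟨ cong (g v +_) (sum-agree-off u f≡h) ⟩
  g v + (h u + sum f) ≡⟨ cong (λ x → g v + (x + sum f)) (updateAt-updates u f) ⟩
  g v + (g u + sum f) ≡⟨ x∙yz≈y∙xz (g v) (g u) _ ⟩
  g u + (g v + sum f) ≡⟨ +-assoc (g u) _ _ ⟨
  g u + g v + sum f   ∎
  where
  open ≡-Reasoning
  h : Fin _ → ℕ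
  h = updateAt f u (const (g u))
  hᵥ≡fᵥ : h v ≡ f v
  hᵥ≡fᵥ = updateAt-minimal v u f (u≢v ∘ sym)
  f≡h : ∀ j → j ≢ u → f j ≡ h j
  f≡h j j≢u = sym (updateAt-minimal j u f j≢u)
  h≡g : ∀ j → j ≢ v → h j ≡ g j
  h≡g j j≢v with j ≟ᶠ u
  ... | yes refl = updateAt-updates u f
  ... | no j≢u   = trans (updateAt-minimal j u f j≢u) (eq j j≢u j≢v)

sum-≤ : ∀ {m} (f : Fin m → ℕ) {b} → (∀ i → f i ≤ b) → sum f ≤ m * b
sum-≤ {zero}  f f≤b = z≤n
sum-≤ {suc m} f f≤b = +-mono-≤ (f≤b fzero) (sum-≤ (f ∘ fsuc) (f≤b ∘ fsuc))

-- (d + 1)² + (d - 1)² = 2 d² + 2, written for d = e + 1.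
squares-exchange : ∀ e a b → suc e * suc e + suc e * suc e + b ≡ suc (suc e) * suc (suc e) + e * e + a →
                   b ≡ 2 + a
squares-exchange e a b eq = +-cancelˡ-≡ (suc e * suc e + suc e * suc e) b (2 + a) (trans eq (identity e a))
  where
  identity : ∀ e a → suc (suc e) * suc (suc e) + e * e + a ≡ suc e * suc e + suc e * suc e + (2 + a)
  identity = solve-∀

hill-climb : {S : Set} {Bad : S → Set} → (∀ s → Dec (Bad s)) →
             (Φ : S → ℕ) (bound : ℕ) → (∀ s → Φ s ≤ bound) →
             (∀ s → Bad s → ∃ λ s′ → Φ s < Φ s′) → S → ∃ λ s → ¬ Bad s
hill-climb {S} {Bad} bad? Φ bound Φ≤bound improve s₀ = climb (suc bound) s₀ (m≤n+m (suc bound) (Φ s₀))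
  where
  climb : (fuel : ℕ) (s : S) → bound < Φ s + fuel → ∃ λ s → ¬ Bad s
  climb zero s bound<Φs = ⊥-elim (<⇒≱ (subst (bound <_) (+-identityʳ (Φ s)) bound<Φs) (Φ≤bound s))
  climb (suc fuel) s bound<Φs+fuel with bad? s
  ... | no ¬bad = s , ¬bad
  ... | yes bad with improve s bad
  ...   | s′ , Φs<Φs′ = climb fuel s′ (begin-strict
    bound            <⟨ bound<Φs+fuel ⟩
    Φ s + suc fuel   ≡⟨ +-suc (Φ s) fuel ⟩
    suc (Φ s) + fuel ≤⟨ +-monoˡ-≤ fuel Φs<Φs′ ⟩
    Φ s′ + fuel      ∎)
    where open ≤-Reasoning

module _ {G : Graph} where

  private
    V = Fin (n G)

  adjacent-sym : ∀ {u v} → Adjacent G u v → Adjacent G v u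
  adjacent-sym {u} {v} uv = trans (Defs.sym G v u) uv

  adjacent-irrefl : ∀ {u v} → Adjacent G u v → u ≢ v
  adjacent-irrefl {u} uv refl with () ← trans (sym (irrefl G u)) uv

  indegree≤degree : (D : Orientation G) (v : V) → indegree D v ≤ degree G v
  indegree≤degree D v = count-mono (λ u → arc-edge D u v)

  orientByRank : (r : V → ℕ) → (∀ u v → Adjacent G u v → r u ≢ r v) → Orientation G
  orientByRank r r-injective = record
    { arc = arcᵣ ; arc-edge = arc-edgeᵣ ; one-way = one-wayᵣ ; some-way = some-wayᵣ }
    where
    arcᵣ : V → V → Bool
    arcᵣ u v = adj G u v ∧ does (r u <? r v)
    arc-edgeᵣ : ∀ u v → arcᵣ u v ≡ true → Adjacent G u v
    arc-edgeᵣ u v uv with adj G u v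
    ... | true = refl
    arcᵣ⇒< : ∀ {u v} → arcᵣ u v ≡ true → r u < r v
    arcᵣ⇒< {u} {v} uv = <ᵇ⇒< (r u) (r v) (Equivalence.from T-≡ (∧-conicalʳ (adj G u v) _ uv))
    one-wayᵣ : ∀ u v → arcᵣ u v ≡ true → arcᵣ v u ≡ false
    one-wayᵣ u v uv = trans (cong (adj G v u ∧_) (dec-false (r v <? r u) (<⇒≯ (arcᵣ⇒< uv)))) (∧-zeroʳ _)
    some-wayᵣ : ∀ u v → Adjacent G u v → arcᵣ u v ≡ false → arcᵣ v u ≡ true
    some-wayᵣ u v uv ¬uv = cong₂ _∧_ (adjacent-sym uv) (dec-true (r v <? r u) rv<ru)
      where
      ru≮rv : ¬ r u < r v
      ru≮rv ru<rv with () ← trans (sym (cong₂ _∧_ uv (dec-true (r u <? r v) ru<rv))) ¬uv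
      rv<ru : r v < r u
      rv<ru = ≤∧≢⇒< (≮⇒≥ ru≮rv) (r-injective v u (adjacent-sym uv))

  indegree-orientByRank : ∀ r r-injective b → (∀ x → Adjacent G x b → r b < r x) →
                          indegree (orientByRank r r-injective) b ≡ 0
  indegree-orientByRank r _ b rb<rx = count-none noArc
    where
    noArc : ∀ x → adj G x b ∧ does (r x <? r b) ≡ false
    noArc x with adj G x b in xb
    ... | false = refl
    ... | true  = dec-false (r x <? r b) (<⇒≯ (rb<rx x xb))

  reverseOn : (D : Orientation G) {ℓ : Level} {R : Rel V ℓ} → Decidable R → Symmetric R → Orientation G
  reverseOn D {R} R? R-sym = record
    { arc = arc′ ; arc-edge = arc-edge′ ; one-way = one-way′ ; some-way = some-way′ }
    where
    arc′ : V → V → Bool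
    arc′ x y = if does (R? x y) then arc D y x else arc D x y
    arc-edge′ : ∀ x y → arc′ x y ≡ true → Adjacent G x y
    arc-edge′ x y xy with R? x y
    ... | yes _ = adjacent-sym (arc-edge D y x xy)
    ... | no _  = arc-edge D x y xy
    one-way′ : ∀ x y → arc′ x y ≡ true → arc′ y x ≡ false
    one-way′ x y xy with R? x y | R? y x
    ... | yes _  | yes _   = one-way D y x xy
    ... | yes Rxy | no ¬Ryx = ⊥-elim (¬Ryx (R-sym Rxy))
    ... | no ¬Rxy | yes Ryx = ⊥-elim (¬Rxy (R-sym Ryx))
    ... | no _   | no _    = one-way D x y xy
    some-way′ : ∀ x y → Adjacent G x y → arc′ x y ≡ false → arc′ y x ≡ true
    some-way′ x y xy ¬xy with R? x y | R? y x
    ... | yes _  | yes _   = some-way D y x (adjacent-sym xy) ¬xy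
    ... | yes Rxy | no ¬Ryx = ⊥-elim (¬Ryx (R-sym Rxy))
    ... | no ¬Rxy | yes Ryx = ⊥-elim (¬Rxy (R-sym Ryx))
    ... | no _   | no _    = some-way D x y xy ¬xy

  module _ (D : Orientation G) {ℓ : Level} {R : Rel V ℓ} (R? : Decidable R) (R-sym : Symmetric R) {x y : V} where

    arc-reverseOn-∈ : R x y → arc (reverseOn D R? R-sym) x y ≡ arc D y x
    arc-reverseOn-∈ Rxy = cong (if_then arc D y x else arc D x y) (dec-true (R? x y) Rxy)

    arc-reverseOn-∉ : ¬ R x y → arc (reverseOn D R? R-sym) x y ≡ arc D x y
    arc-reverseOn-∉ ¬Rxy = cong (if_then arc D y x else arc D x y) (dec-false (R? x y) ¬Rxy)

  OnEdge : V → V → Rel V 0ℓ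
  OnEdge u v x y = (x ≡ u × y ≡ v) ⊎ (x ≡ v × y ≡ u)

  onEdge? : ∀ u v → Decidable (OnEdge u v)
  onEdge? u v x y = (x ≟ᶠ u ×-dec y ≟ᶠ v) ⊎-dec (x ≟ᶠ v ×-dec y ≟ᶠ u)

  onEdge-sym : ∀ u v → Symmetric (OnEdge u v)
  onEdge-sym u v = Sum.swap ∘ Sum.map Product.swap Product.swap

  reverseArc : Orientation G → V → V → Orientation G
  reverseArc D u v = reverseOn D (onEdge? u v) (onEdge-sym u v)

  module _ (D : Orientation G) {u v : V} where

    private
      D′ = reverseArc D u v

      arc-on-edge : ∀ {x y} → OnEdge u v x y → arc D′ x y ≡ arc D y x
      arc-on-edge = arc-reverseOn-∈ D (onEdge? u v) (onEdge-sym u v)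

      arc-off-edge : ∀ {x y} → ¬ OnEdge u v x y → arc D′ x y ≡ arc D x y
      arc-off-edge = arc-reverseOn-∉ D (onEdge? u v) (onEdge-sym u v)

    indegree-reverseArc-≢ : ∀ {y} → y ≢ u → y ≢ v → indegree D′ y ≡ indegree D y
    indegree-reverseArc-≢ y≢u y≢v = count-cong λ x →
      arc-off-edge {x} [ y≢v ∘ proj₂ , y≢u ∘ proj₂ ]

    module _ (uv : arc D u v ≡ true) where

      private
        u≢v : u ≢ v
        u≢v = adjacent-irrefl (arc-edge D u v uv)

      indegree-reverseArc-head : indegree D v ≡ suc (indegree D′ v)
      indegree-reverseArc-head = count-update u uv
        (trans (arc-on-edge (inj₁ (refl , refl))) (one-way D u v uv))
        (λ x x≢u → sym (arc-off-edge [ x≢u ∘ proj₁ , u≢v ∘ sym ∘ proj₂ ]))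

      indegree-reverseArc-tail : indegree D′ u ≡ suc (indegree D u)
      indegree-reverseArc-tail = count-update v
        (trans (arc-on-edge (inj₂ (refl , refl))) uv)
        (one-way D u v uv)
        (λ x x≢v → arc-off-edge [ u≢v ∘ proj₂ , x≢v ∘ proj₁ ])

      module _ (u≡v : indegree D u ≡ indegree D v) where

        indegree-reverseArc-zero : ∀ {y} → indegree D y ≡ 0 → indegree D′ y ≡ 0
        indegree-reverseArc-zero {y} y₀ = trans (indegree-reverseArc-≢ y≢u y≢v) y₀
          where
          y≢v : y ≢ v
          y≢v refl with () ← trans (sym y₀) indegree-reverseArc-head
          y≢u : y ≢ u
          y≢u refl with () ← trans (sym (trans (sym u≡v) y₀)) indegree-reverseArc-head

  potential : Orientation G → ℕ
  potential D = sum λ v → indegree D v * indegree D v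

  potential-≤ : (D : Orientation G) → potential D ≤ n G * (n G * n G)
  potential-≤ D = sum-≤ _ λ v → *-mono-≤ (count-≤ λ u → arc D u v) (count-≤ λ u → arc D u v)

  potential-reverseArc : (D : Orientation G) {u v : V} → arc D u v ≡ true → indegree D u ≡ indegree D v →
                         potential (reverseArc D u v) ≡ 2 + potential D
  potential-reverseArc D {u} {v} uv u≡v = squares-exchange e (potential D) (potential D′) (begin
    sq (suc e) + sq (suc e) + potential D′ ≡⟨ cong₂ (λ a b → sq a + sq b + potential D′) uᵒ vᵒ ⟨
    f u + f v + sum g                     ≡⟨ sum-agree-off₂ u v (adjacent-irrefl (arc-edge D u v uv)) agree ⟩
    g u + g v + sum f                     ≡⟨ cong (λ a → sq a + g v + potential D) uⁿ ⟩
    sq (suc (suc e)) + sq e + potential D ∎)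
    where
    open ≡-Reasoning
    D′ = reverseArc D u v
    sq : ℕ → ℕ
    sq x = x * x
    f g : V → ℕ
    f = sq ∘ indegree D
    g = sq ∘ indegree D′
    e = indegree D′ v
    vᵒ : indegree D v ≡ suc e
    vᵒ = indegree-reverseArc-head D uv
    uᵒ : indegree D u ≡ suc e
    uᵒ = trans u≡v vᵒ
    uⁿ : indegree D′ u ≡ suc (suc e)
    uⁿ = trans (indegree-reverseArc-tail D uv) (cong suc uᵒ)
    agree : ∀ j → j ≢ u → j ≢ v → f j ≡ g j
    agree j j≢u j≢v = cong sq (sym (indegree-reverseArc-≢ D j≢u j≢v))

  Conflict : Orientation G → Set
  Conflict D = ∃₂ λ u v → arc D u v ≡ true × indegree D u ≡ indegree D v

  conflict? : (D : Orientation G) → Dec (Conflict D)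
  conflict? D = any? λ u → any? λ v → (arc D u v ≟ᵇ true) ×-dec (indegree D u ≟ indegree D v)

  ¬Conflict⇒Proper : (D : Orientation G) → ¬ Conflict D → Proper D
  ¬Conflict⇒Proper D ¬conflict u v uv u≡v with arc D u v in arc-uv
  ... | true  = ¬conflict (u , v , arc-uv , u≡v)
  ... | false = ¬conflict (v , u , some-way D u v uv arc-uv , sym u≡v)

module _ {G : Graph} {c : ℕ} where

  private
    V = Fin (n G)

  Big : V → Set
  Big v = suc c ≤ degree G v

  Sourced : Orientation G → Set
  Sourced D = ∀ b → Big b → indegree D b ≡ 0

  sourced⇒indegree≤c : (D : Orientation G) → Sourced D → IsKOrientation c D
  sourced⇒indegree≤c D sourced v with c <? degree G v
  ... | yes bigᵥ = subst (_≤ c) (sym (sourced v bigᵥ)) z≤n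
  ... | no ¬bigᵥ = ≤-trans (indegree≤degree D v) (≮⇒≥ ¬bigᵥ)

  module _ (big-independent : ∀ u v → Adjacent G u v → ¬ (Big u × Big v)) where

    rank : V → ℕ
    rank v with c <? degree G v
    ... | yes _ = 0
    ... | no _  = suc (toℕ v)

    rank-injective : ∀ u v → Adjacent G u v → rank u ≢ rank v
    rank-injective u v uv with c <? degree G u | c <? degree G v
    ... | yes bigᵤ | yes bigᵥ = λ _ → big-independent u v uv (bigᵤ , bigᵥ)
    ... | yes _    | no _     = λ ()
    ... | no _     | yes _    = λ ()
    ... | no _     | no _     = λ ru≡rv → adjacent-irrefl {G} uv (toℕ-injective (suc-injective ru≡rv))

    rank-big : ∀ b x → Big b → Adjacent G x b → rank b < rank x
    rank-big b x bigᵦ xb with c <? degree G b | c <? degree G x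
    ... | no ¬bigᵦ | _        = ⊥-elim (¬bigᵦ bigᵦ)
    ... | yes _    | yes bigₓ = ⊥-elim (big-independent x b xb (bigₓ , bigᵦ))
    ... | yes _    | no _     = z<s

    sourced-orientation : Σ (Orientation G) Sourced
    sourced-orientation = orientByRank rank rank-injective ,
      λ b bigᵦ → indegree-orientByRank {G} rank rank-injective b (λ x → rank-big b x bigᵦ)

    sourced-conflict-free : ∃ λ (S : Σ (Orientation G) Sourced) → ¬ Conflict (proj₁ S)
    sourced-conflict-free = hill-climb (conflict? ∘ proj₁) (potential ∘ proj₁) _ (potential-≤ ∘ proj₁)
                                       improve sourced-orientation
      where
      improve : ∀ S → Conflict (proj₁ S) → ∃ λ S′ → potential (proj₁ S) < potential (proj₁ S′)
      improve (D , sourced) (u , v , uv , u≡v) =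
        (reverseArc D u v , λ b bigᵦ → indegree-reverseArc-zero D uv u≡v (sourced b bigᵦ)) ,
        subst (potential D <_) (sym (potential-reverseArc D uv u≡v)) (m<n+m (potential D) z<s)

corollary25 : (G : Graph) (c : ℕ) → 1 ≤ c →
    (∀ u v → Adjacent G u v → ¬ (suc c ≤ degree G u × suc c ≤ degree G v)) →
    ProperOrientationNumber≤ G c
corollary25 G c _ big-independent with sourced-conflict-free big-independent
... | (D , sourced) , ¬conflict = D , ¬Conflict⇒Proper D ¬conflict , sourced⇒indegree≤c D sourced
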